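{- Let $r$ be a fixed integer. There is a polynomial $q_r$ (depending only on $r$) such that for every integer $n$, every $A\subseteq[n]$ with $|A|\le r$, and every cone $\mathcal C\subseteq\mathbb R^n$ generated by extremal rays $\{r_1,\dots,r_l\}\subseteq R_A$, any triangulation of $\mathrm{conv}\{0,r_1,\dots,r_l\}$ (with vertices among these points) has at most $q_r(n)$ top-dimensional simplices.
   Context: $e_i$ denotes the $i$-th standard unit vector of $\mathbb R^n$. For $A\subseteq[n]$ the elementary set of $A$ is $R_A=\{e_i-e_j,\ e_i,\ -e_j : i\in[n],\ j\in A\}$. -}

module Defs where

open import Data.Nat using (ℕ; zero; suc)
open import Data.Fin using (Fin; zero; suc)
open import Data.Fin.Subset using (Subset; _∈_; _∉_; _∩_; ⊤)
open import Data.Rational using (ℚ; 0ℚ; 1ℚ; _+_; _*_; -_; _≤_; _/_)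
open import Data.Integer using (+_)
open import Data.Product using (Σ; _×_; ∃)
open import Data.List using (List; []; _∷_)
open import Relation.Binary.PropositionalEquality using (_≡_)
open import Relation.Nullary using (¬_)

Vecℚ : ℕ → Set
Vecℚ n = Fin n → ℚ

_≋_ : ∀ {n} → Vecℚ n → Vecℚ n → Set
x ≋ y = ∀ k → x k ≡ y k

𝟎 : ∀ {n} → Vecℚ n
𝟎 _ = 0ℚ

_⊕_ : ∀ {n} → Vecℚ n → Vecℚ n → Vecℚ n
(x ⊕ y) k = x k + y k

_·_ : ∀ {n} → ℚ → Vecℚ n → Vecℚ n
(t · x) k = t * x k

e : ∀ {n} → Fin n → Vecℚ n
e zero zero = 1ℚ
e zero (suc k) = 0ℚ
e (suc i) zero = 0ℚ
e (suc i) (suc k) = e i k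

sumℚ : ∀ {m} → (Fin m → ℚ) → ℚ
sumℚ {zero} w = 0ℚ
sumℚ {suc m} w = w zero + sumℚ (λ i → w (suc i))

lincomb : ∀ {m n} → (Fin m → ℚ) → (Fin m → Vecℚ n) → Vecℚ n
lincomb w p k = sumℚ (λ i → w i * p i k)

InR : ∀ {n} → Subset n → Vecℚ n → Set
InR {n} A v =
  (Σ (Fin n) λ i → Σ (Fin n) λ j → j ∈ A × (v ≋ (e i ⊕ ((- 1ℚ) · e j))))
  ⊎' ((Σ (Fin n) λ i → v ≋ e i)
  ⊎' (Σ (Fin n) λ j → j ∈ A × (v ≋ ((- 1ℚ) · e j))))
  where
  open import Data.Sum using () renaming (_⊎_ to _⊎'_)

InCone : ∀ {l n} → (Fin l → Vecℚ n) → Vecℚ n → Set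
InCone rs x = Σ (Fin _ → ℚ) λ w → (∀ i → 0ℚ ≤ w i) × (lincomb w rs ≋ x)

OnRay : ∀ {n} → Vecℚ n → Vecℚ n → Set
OnRay v x = Σ ℚ λ t → (0ℚ ≤ t) × (x ≋ (t · v))

IsExtremalRay : ∀ {n} → (Vecℚ n → Set) → Vecℚ n → Set
IsExtremalRay C v =
  C v × ¬ (v ≋ 𝟎) ×
  (∀ x y → C x → C y → OnRay v (x ⊕ y) → OnRay v x × OnRay v y)

points : ∀ {l n} → (Fin l → Vecℚ n) → Fin (suc l) → Vecℚ n
points rs zero = 𝟎
points rs (suc i) = rs i

Supported : ∀ {m} → Subset m → (Fin m → ℚ) → Set
Supported S w = ∀ i → i ∉ S → w i ≡ 0ℚ

InConv : ∀ {m n} → (Fin m → Vecℚ n) → Subset m → Vecℚ n → Set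
InConv p S x = Σ (Fin _ → ℚ) λ w →
  Supported S w × (∀ i → 0ℚ ≤ w i) × (sumℚ w ≡ 1ℚ) × (lincomb w p ≋ x)

InAff : ∀ {m n} → (Fin m → Vecℚ n) → Subset m → Vecℚ n → Set
InAff p S x = Σ (Fin _ → ℚ) λ w →
  Supported S w × (sumℚ w ≡ 1ℚ) × (lincomb w p ≋ x)

-- {p_i : i ∈ S} affinely independent (and the p_i, i ∈ S, pairwise distinct)
AffInd : ∀ {m n} → (Fin m → Vecℚ n) → Subset m → Set
AffInd p S = ∀ w → Supported S w → sumℚ w ≡ 0ℚ → lincomb w p ≋ 𝟎 → ∀ i → w i ≡ 0ℚ

TopDim : ∀ {m n} → (Fin m → Vecℚ n) → Subset m → Set
TopDim p S = AffInd p S × (∀ j → InAff p S (p j))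

IsTriangulation : ∀ {m n} → (Fin m → Vecℚ n) → (Subset m → Set) → Set
IsTriangulation p T =
  (∀ σ → T σ → AffInd p σ) ×
  (∀ x → InConv p ⊤ x → Σ (Subset _) λ σ → T σ × InConv p σ x) ×
  (∀ σ τ → T σ → T τ → ∀ x → InConv p σ x → InConv p τ x → InConv p (σ ∩ τ) x)

-- polynomials with rational coefficients (constant term first), evaluated at a natural number
evalPoly : List ℚ → ℕ → ℚ
evalPoly [] n = 0ℚ
evalPoly (c ∷ cs) n = c + (+ n / 1) * evalPoly cs n

{-# OPTIONS --safe #-}
-- Put the origin and the rays together as points e_pos − e_neg with pos ∈ [n] ∪ {∅} and
-- neg ∈ A ∪ {∅}; being distinct, there are at most (n+1)² of them.  Distinct cells of a
-- triangulation have disjoint relative interiors, so a cell σ is determined by its barycentre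
-- (1/|σ|)(#pos_k(σ) − #neg_k(σ))_k.  For a top-dimensional σ and k ∉ A, #neg_k(σ) = 0, and if
-- #pos_k(σ) ≤ 1 it is 1 exactly when some point has pos = k, because the affine hull of σ
-- contains every point.  The directions k with #pos_k(σ) ≥ 2 are injectively labelled by the
-- negative parts of two such vertices (by affine independence), so σ is encoded by |σ| and at
-- most |A| + (|A|+1)² triples (k, #pos_k, #neg_k) with entries below (n+1)² + 2, and there
-- are polynomially many such codes for fixed r.
module Submission where

open import Defs
open import Data.Nat using (ℕ; suc)
open import Data.Fin using (Fin)
open import Data.Fin.Subset using (Subset; ∣_∣)
open import Data.Rational using (ℚ; _/_)
open import Data.Integer using (+_)
open import Data.Product using (Σ; _×_)
open import Data.List using (List; length)
open import Data.List.Relation.Unary.All using (All)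
open import Data.List.Relation.Unary.Unique.Propositional using (Unique)
open import Relation.Binary.PropositionalEquality using (_≡_)

open import Algebra.Bundles using (CommutativeRing)
open import Data.Bool using (true; false; if_then_else_)
open import Data.Empty using (⊥-elim)
open import Data.Fin using (zero; suc; _≟_)
open import Data.Fin.Subset using (inside; outside; ⊤; _∩_; _⊆_; Nonempty) renaming (_∈_ to _∈ₛ_; _∉_ to _∉ₛ_)
open import Data.Fin.Subset.Properties using (_∈?_; nonempty?; x∈p⇒∣p-x∣<∣p∣; ∣p∣≤n; ∣⊤∣≡n; ∈⊤; p∩q⊆p; p∩q⊆q; ⊆-antisym)
import Data.Integer as ℤ
import Data.Integer.Properties as ℤ
open import Data.List using ([]; _∷_; map; filter; allFin; tabulate; upTo; cartesianProduct; cartesianProductWith; _++_)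
open import Data.List.Properties using (length-++; length-map; length-filter; filter-none; length-tabulate; length-upTo; length-removeAt′)
open import Data.List.Membership.Propositional using (_∈_; _─_)
open import Data.List.Membership.Propositional.Properties
  using (∈-filter⁺; ∈-filter⁻; ∈-allFin; ∈-length; ∈-map⁺; ∈-map⁻; ∈-cartesianProductWith⁺; ∈-cartesianProduct⁺; ∈-++⁺ˡ; ∈-++⁺ʳ; ∈-upTo⁺)
open import Data.List.Relation.Unary.Any using (here; there)
open import Data.List.Relation.Unary.All using ([]; _∷_)
import Data.List.Relation.Unary.All as All
import Data.List.Relation.Unary.All.Properties as All
open import Data.List.Relation.Unary.AllPairs using (_∷_)
open import Data.List.Relation.Unary.Unique.Propositional.Properties using (allFin⁺; filter⁺)
open import Data.Maybe using (Maybe; just; nothing)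
open import Data.Maybe.Properties using (≡-dec; just-injective)
open import Data.Nat as ℕ using (zero; z≤n; s≤s; _≤_)
import Data.Nat.Properties as ℕ
open import Data.Nat.Coprimality as Coprime using (1-coprimeTo)
open import Data.Product using (∃; _,_; proj₁; proj₂)
open import Data.Rational as ℚ using (0ℚ; 1ℚ; 1/_)
import Data.Rational.Properties as ℚ
open import Data.Sum using (_⊎_; inj₁; inj₂)
import Data.Vec as Vec
open import Function using (_∘_; id)
open import Level using (0ℓ)
open import Relation.Binary using (DecidableEquality)
open import Relation.Binary.PropositionalEquality using (_≢_; refl; sym; trans; cong; cong₂; subst; module ≡-Reasoning)
open import Relation.Nullary using (¬_; Dec; does; yes; no; _×-dec_; _⊎-dec_; contradiction)
open import Relation.Nullary.Decidable using (dec⇒maybe; dec-true; dec-false)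
open import Relation.Unary using (Pred; Decidable)
open import Algebra.Properties.Group ℚ.+-0-group using (x∙y⁻¹≈ε⇒x≈y; x≈y⇒x∙y⁻¹≈ε)
open import Algebra.Properties.Semiring.Mult (CommutativeRing.semiring ℚ.+-*-commutativeRing)
  using (×-homo-+; ×1-homo-*) renaming (_×_ to _×ℚ_)
open import Tactic.RingSolver using (solve-∀)
open import Tactic.RingSolver.Core.AlmostCommutativeRing using (AlmostCommutativeRing; fromCommutativeRing)

-- Counting with lists

module _ {X : Set} where

  ∈-─⁺ : ∀ {x y : X} {ys} (x∈ys : x ∈ ys) → x ≢ y → (y∈ys : y ∈ ys) → x ∈ ys ─ y∈ys
  ∈-─⁺ (here refl) x≢y (here refl) = ⊥-elim (x≢y refl)
  ∈-─⁺ (here x≡z)  _   (there _)   = here x≡z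
  ∈-─⁺ (there x∈)  _   (here _)    = x∈
  ∈-─⁺ (there x∈)  x≢y (there y∈)  = there (∈-─⁺ x∈ x≢y y∈)

module _ {X Y : Set} where

  injection⇒length≤ : (R : X → Y → Set) {xs : List X} {ys : List Y} → Unique xs →
    (∀ {x} → x ∈ xs → ∃ λ y → y ∈ ys × R x y) →
    (∀ {x x′ y} → x ∈ xs → x′ ∈ xs → R x y → R x′ y → x ≡ x′) →
    length xs ≤ length ys
  injection⇒length≤ R {[]} _ _ _ = z≤n
  injection⇒length≤ R {x ∷ xs} {ys} (x∉xs ∷ unique) image injective
    with y , y∈ys , Rxy ← image (here refl) =
    subst (suc (length xs) ≤_) (sym (length-removeAt′ ys _))
      (s≤s (injection⇒length≤ R unique image′ (λ m m′ → injective (there m) (there m′))))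
    where
    image′ : ∀ {x′} → x′ ∈ xs → ∃ λ y′ → y′ ∈ ys ─ y∈ys × R x′ y′
    image′ x′∈xs with y′ , y′∈ys , Rx′y′ ← image (there x′∈xs) =
      y′ , ∈-─⁺ y′∈ys y′≢y y∈ys , Rx′y′
      where
      y′≢y : y′ ≢ y
      y′≢y refl = All.lookup x∉xs x′∈xs (injective (here refl) (there x′∈xs) Rxy Rx′y′)

module _ {X Y Z : Set} (f : X → Y → Z) where

  length-cartesianProductWith : ∀ xs ys → length (cartesianProductWith f xs ys) ≡ length xs ℕ.* length ys
  length-cartesianProductWith []       ys = refl
  length-cartesianProductWith (x ∷ xs) ys = begin
    length (map (f x) ys ++ cartesianProductWith f xs ys)  ≡⟨ length-++ (map (f x) ys) ⟩
    length (map (f x) ys) ℕ.+ length (cartesianProductWith f xs ys)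
      ≡⟨ cong₂ ℕ._+_ (length-map (f x) ys) (length-cartesianProductWith xs ys) ⟩
    length ys ℕ.+ length xs ℕ.* length ys  ∎
    where open ≡-Reasoning

module _ {X : Set} where

  subset⇒length≤ : {xs ys : List X} → Unique xs → (∀ {x} → x ∈ xs → x ∈ ys) → length xs ≤ length ys
  subset⇒length≤ unique xs⊆ys = injection⇒length≤ _≡_ unique (λ x∈xs → _ , xs⊆ys x∈xs , refl) (λ _ _ x≡y x′≡y → trans x≡y (sym x′≡y))

  Unique⇒two-distinct : {xs : List X} → Unique xs → 2 ≤ length xs →
    ∃ λ u → ∃ λ w → u ≢ w × u ∈ xs × w ∈ xs
  Unique⇒two-distinct {u ∷ w ∷ _} ((u≢w ∷ _) ∷ _) _         = u , w , u≢w , here refl , there (here refl)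
  Unique⇒two-distinct {_ ∷ []}    _                (s≤s ())

  lists≤ : ℕ → List X → List (List X)
  lists≤ zero    xs = [] ∷ []
  lists≤ (suc m) xs = [] ∷ cartesianProductWith _∷_ xs (lists≤ m xs)

  ∈-lists≤ : ∀ m {xs zs : List X} → All (_∈ xs) zs → length zs ≤ m → zs ∈ lists≤ m xs
  ∈-lists≤ zero    []           _         = here refl
  ∈-lists≤ (suc m) []           _         = here refl
  ∈-lists≤ (suc m) (z∈xs ∷ zs∈) (s≤s len) = there (∈-cartesianProductWith⁺ _∷_ z∈xs (∈-lists≤ m zs∈ len))

  length-lists≤ : ∀ m (xs : List X) → length (lists≤ m xs) ≤ suc (length xs) ℕ.^ m
  length-lists≤ zero    xs = ℕ.≤-refl
  length-lists≤ (suc m) xs = ℕ.+-mono-≤ (ℕ.m^n>0 (suc (length xs)) m) (begin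
    length (cartesianProductWith _∷_ xs (lists≤ m xs))  ≡⟨ length-cartesianProductWith _∷_ xs (lists≤ m xs) ⟩
    length xs ℕ.* length (lists≤ m xs)                  ≤⟨ ℕ.*-monoʳ-≤ (length xs) (length-lists≤ m xs) ⟩
    length xs ℕ.* suc (length xs) ℕ.^ m                 ∎)
    where open ℕ.≤-Reasoning

members : ∀ {m ℓ} {P : Pred (Fin m) ℓ} → Decidable P → List (Fin m)
members P? = filter P? (allFin _)

module _ {m ℓ} {P : Pred (Fin m) ℓ} (P? : Decidable P) where

  members-unique : Unique (members P?)
  members-unique = filter⁺ P? (allFin⁺ m)

  ∈-members⁺ : ∀ {i} → P i → i ∈ members P?
  ∈-members⁺ = ∈-filter⁺ P? (∈-allFin _)

  ∈-members⁻ : ∀ {i} → i ∈ members P? → P i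
  ∈-members⁻ i∈ = proj₂ (∈-filter⁻ P? {xs = allFin m} i∈)

  members-none : (∀ i → ¬ P i) → length (members P?) ≡ 0
  members-none ¬P = cong length (filter-none P? (All.universal ¬P (allFin m)))

  length-members≡0⇒¬ : length (members P?) ≡ 0 → ∀ {i} → ¬ P i
  length-members≡0⇒¬ len≡0 Pi = ℕ.<-irrefl (sym len≡0) (∈-length (∈-members⁺ Pi))

  two-members : 2 ≤ length (members P?) → ∃ λ u → ∃ λ w → u ≢ w × P u × P w
  two-members 2≤len with u , w , u≢w , u∈ , w∈ ← Unique⇒two-distinct members-unique 2≤len =
    u , w , u≢w , ∈-members⁻ u∈ , ∈-members⁻ w∈

  length-members≤ : length (members P?) ≤ m
  length-members≤ = ℕ.≤-trans (length-filter P? (allFin m)) (ℕ.≤-reflexive (length-tabulate id))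

Nonempty⇒∣p∣>0 : ∀ {n} {p : Subset n} → Nonempty p → 0 ℕ.< ∣ p ∣
Nonempty⇒∣p∣>0 (_ , x∈p) = ℕ.≤-<-trans z≤n (x∈p⇒∣p-x∣<∣p∣ x∈p)

length-filter-∈?-tail : ∀ {m n} b (p : Subset n) (f : Fin m → Fin n) →
  length (filter (_∈? b Vec.∷ p) (tabulate (suc ∘ f))) ≡ length (filter (_∈? p) (tabulate f))
length-filter-∈?-tail {zero}  b p f = refl
length-filter-∈?-tail {suc m} b p f with does (f zero ∈? p)
... | true  = cong suc (length-filter-∈?-tail b p (f ∘ suc))
... | false = length-filter-∈?-tail b p (f ∘ suc)

length-members-∈? : ∀ {n} (p : Subset n) → length (members (_∈? p)) ≡ ∣ p ∣
length-members-∈? Vec.[]            = refl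
length-members-∈? (inside Vec.∷ p)  = cong suc (trans (length-filter-∈?-tail inside p id) (length-members-∈? p))
length-members-∈? (outside Vec.∷ p) = trans (length-filter-∈?-tail outside p id) (length-members-∈? p)

-- Rationals and finite sums

ℚ-ring : AlmostCommutativeRing 0ℓ 0ℓ
ℚ-ring = fromCommutativeRing ℚ.+-*-commutativeRing (λ x → dec⇒maybe (0ℚ ℚ.≟ x))

fromℕ : ℕ → ℚ
fromℕ n = n ×ℚ 1ℚ

fromℕ-+ : ∀ m n → fromℕ (m ℕ.+ n) ≡ fromℕ m ℚ.+ fromℕ n
fromℕ-+ = ×-homo-+ 1ℚ

fromℕ-* : ∀ m n → fromℕ (m ℕ.* n) ≡ fromℕ m ℚ.* fromℕ n
fromℕ-* = ×1-homo-*

fromℕ-nonNeg : ∀ n → 0ℚ ℚ.≤ fromℕ n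
fromℕ-nonNeg zero    = ℚ.≤-refl
fromℕ-nonNeg (suc n) = ℚ.+-mono-≤ (ℚ.nonNegative⁻¹ 1ℚ) (fromℕ-nonNeg n)

fromℕ-mono : ∀ {m n} → m ≤ n → fromℕ m ℚ.≤ fromℕ n
fromℕ-mono {zero}  {n}     _         = fromℕ-nonNeg n
fromℕ-mono {suc m} {suc n} (s≤s m≤n) = ℚ.+-monoʳ-≤ 1ℚ (fromℕ-mono m≤n)

/1≡fromℕ : ∀ n → + n / 1 ≡ fromℕ n
/1≡fromℕ zero    = refl
/1≡fromℕ (suc n) = trans /1-suc (cong (1ℚ ℚ.+_) (/1≡fromℕ n))
  where
  /1-suc : + suc n / 1 ≡ 1ℚ ℚ.+ + n / 1
  /1-suc rewrite ℚ.normalize-coprime {n} {0} (Coprime.sym (1-coprimeTo n)) =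
    cong (_/ 1) (cong (ℤ._+_ (+ 1)) (sym (ℤ.*-identityʳ (+ n))))

fromℕ-invertible : ∀ {k} → 0 ℕ.< k → Σ ℚ λ t → 0ℚ ℚ.≤ t × t ℚ.* fromℕ k ≡ 1ℚ
fromℕ-invertible {suc k} _ = t , ℚ.<⇒≤ (ℚ.positive⁻¹ t {{t>0}}) , ℚ.*-inverseˡ s {{s≢0}}
  where
  s : ℚ
  s = fromℕ (suc k)
  instance
    s>0 : ℚ.Positive s
    s>0 = ℚ.pos+nonNeg⇒pos 1ℚ (fromℕ k) {{ℚ.nonNegative (fromℕ-nonNeg k)}}
    s≢0 : ℚ.NonZero s
    s≢0 = ℚ.pos⇒nonZero s
  t : ℚ
  t = 1/ s
  t>0 : ℚ.Positive t
  t>0 = ℚ.1/pos⇒pos s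

𝟙 : ∀ {a} {A : Set a} → Dec A → ℚ
𝟙 A? = if does A? then 1ℚ else 0ℚ

𝟙-yes : ∀ {a} {A : Set a} (A? : Dec A) → A → 𝟙 A? ≡ 1ℚ
𝟙-yes A? a rewrite dec-true A? a = refl

𝟙-no : ∀ {a} {A : Set a} (A? : Dec A) → ¬ A → 𝟙 A? ≡ 0ℚ
𝟙-no A? ¬a rewrite dec-false A? ¬a = refl

sumℚ-cong : ∀ {m} {f g : Fin m → ℚ} → (∀ i → f i ≡ g i) → sumℚ f ≡ sumℚ g
sumℚ-cong {zero}  f≗g = refl
sumℚ-cong {suc m} f≗g = cong₂ ℚ._+_ (f≗g zero) (sumℚ-cong (f≗g ∘ suc))

sumℚ-zero : ∀ {m} {f : Fin m → ℚ} → (∀ i → f i ≡ 0ℚ) → sumℚ f ≡ 0ℚ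
sumℚ-zero {zero}  f≗0 = refl
sumℚ-zero {suc m} f≗0 rewrite f≗0 zero | sumℚ-zero (f≗0 ∘ suc) = refl

sumℚ-*ˡ : ∀ {m} c (f : Fin m → ℚ) → sumℚ (λ i → c ℚ.* f i) ≡ c ℚ.* sumℚ f
sumℚ-*ˡ {zero}  c f = sym (ℚ.*-zeroʳ c)
sumℚ-*ˡ {suc m} c f rewrite sumℚ-*ˡ c (f ∘ suc) = sym (ℚ.*-distribˡ-+ c (f zero) (sumℚ (f ∘ suc)))

sumℚ-+ : ∀ {m} (f g : Fin m → ℚ) → sumℚ (λ i → f i ℚ.+ g i) ≡ sumℚ f ℚ.+ sumℚ g
sumℚ-+ {zero}  f g = refl
sumℚ-+ {suc m} f g rewrite sumℚ-+ (f ∘ suc) (g ∘ suc) =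
  interchange (f zero) (g zero) (sumℚ (f ∘ suc)) (sumℚ (g ∘ suc))
  where
  interchange : ∀ a b c d → (a ℚ.+ b) ℚ.+ (c ℚ.+ d) ≡ (a ℚ.+ c) ℚ.+ (b ℚ.+ d)
  interchange = solve-∀ ℚ-ring

sumℚ-− : ∀ {m} (f g : Fin m → ℚ) → sumℚ (λ i → f i ℚ.- g i) ≡ sumℚ f ℚ.- sumℚ g
sumℚ-− {zero}  f g = refl
sumℚ-− {suc m} f g rewrite sumℚ-− (f ∘ suc) (g ∘ suc) =
  interchange (f zero) (g zero) (sumℚ (f ∘ suc)) (sumℚ (g ∘ suc))
  where
  interchange : ∀ a b c d → (a ℚ.- b) ℚ.+ (c ℚ.- d) ≡ (a ℚ.+ c) ℚ.- (b ℚ.+ d)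
  interchange = solve-∀ ℚ-ring

sumℚ-𝟙≟ : ∀ {m} j (f : Fin m → ℚ) → sumℚ (λ i → 𝟙 (i ≟ j) ℚ.* f i) ≡ f j
sumℚ-𝟙≟ {suc m} zero    f rewrite sumℚ-zero (λ i → ℚ.*-zeroˡ (f (suc i))) =
  trans (ℚ.+-identityʳ _) (ℚ.*-identityˡ (f zero))
sumℚ-𝟙≟ {suc m} (suc j) f rewrite sumℚ-𝟙≟ j (f ∘ suc) =
  trans (cong (ℚ._+ f (suc j)) (ℚ.*-zeroˡ (f zero))) (ℚ.+-identityˡ (f (suc j)))

sumℚ-𝟙 : ∀ {m ℓ} {X : Set} {P : Pred X ℓ} (P? : Decidable P) (f : Fin m → X) →
  sumℚ (λ i → 𝟙 (P? (f i))) ≡ fromℕ (length (filter P? (tabulate f)))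
sumℚ-𝟙 {zero}  P? f = refl
sumℚ-𝟙 {suc m} P? f with does (P? (f zero))
... | true  = cong (1ℚ ℚ.+_) (sumℚ-𝟙 P? (f ∘ suc))
... | false = trans (ℚ.+-identityˡ _) (sumℚ-𝟙 P? (f ∘ suc))

-- Polynomials

infixl 6 _+ₚ_
infixl 7 _*ₚ_
infixr 8 _^ₚ_

_+ₚ_ : List ℚ → List ℚ → List ℚ
[]      +ₚ q       = q
(a ∷ p) +ₚ []      = a ∷ p
(a ∷ p) +ₚ (b ∷ q) = a ℚ.+ b ∷ p +ₚ q

_*ₚ_ : List ℚ → List ℚ → List ℚ
[]      *ₚ q = []
(a ∷ p) *ₚ q = map (a ℚ.*_) q +ₚ (0ℚ ∷ p *ₚ q)

_^ₚ_ : List ℚ → ℕ → List ℚ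
p ^ₚ zero  = 1ℚ ∷ []
p ^ₚ suc m = p *ₚ p ^ₚ m

constₚ : ℕ → List ℚ
constₚ c = fromℕ c ∷ []

Xₚ : List ℚ
Xₚ = 0ℚ ∷ 1ℚ ∷ []

evalPoly-+ₚ : ∀ p q n → evalPoly (p +ₚ q) n ≡ evalPoly p n ℚ.+ evalPoly q n
evalPoly-+ₚ []      q       n = sym (ℚ.+-identityˡ _)
evalPoly-+ₚ (a ∷ p) []      n = sym (ℚ.+-identityʳ _)
evalPoly-+ₚ (a ∷ p) (b ∷ q) n rewrite evalPoly-+ₚ p q n =
  shuffle a b (+ n / 1) (evalPoly p n) (evalPoly q n)
  where
  shuffle : ∀ a b x u v → (a ℚ.+ b) ℚ.+ x ℚ.* (u ℚ.+ v) ≡ (a ℚ.+ x ℚ.* u) ℚ.+ (b ℚ.+ x ℚ.* v)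
  shuffle = solve-∀ ℚ-ring

evalPoly-scale : ∀ c p n → evalPoly (map (c ℚ.*_) p) n ≡ c ℚ.* evalPoly p n
evalPoly-scale c []      n = sym (ℚ.*-zeroʳ c)
evalPoly-scale c (a ∷ p) n rewrite evalPoly-scale c p n = distrib c a (+ n / 1) (evalPoly p n)
  where
  distrib : ∀ c a x u → c ℚ.* a ℚ.+ x ℚ.* (c ℚ.* u) ≡ c ℚ.* (a ℚ.+ x ℚ.* u)
  distrib = solve-∀ ℚ-ring

evalPoly-*ₚ : ∀ p q n → evalPoly (p *ₚ q) n ≡ evalPoly p n ℚ.* evalPoly q n
evalPoly-*ₚ []      q n = sym (ℚ.*-zeroˡ (evalPoly q n))
evalPoly-*ₚ (a ∷ p) q n
  rewrite evalPoly-+ₚ (map (a ℚ.*_) q) (0ℚ ∷ p *ₚ q) n | evalPoly-scale a q n | evalPoly-*ₚ p q n =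
  distrib a (+ n / 1) (evalPoly p n) (evalPoly q n)
  where
  distrib : ∀ a x u v → a ℚ.* v ℚ.+ (0ℚ ℚ.+ x ℚ.* (u ℚ.* v)) ≡ (a ℚ.+ x ℚ.* u) ℚ.* v
  distrib = solve-∀ ℚ-ring

record _Represents_ (p : List ℚ) (f : ℕ → ℕ) : Set where
  constructor represents
  field evalPoly≡ : ∀ n → evalPoly p n ≡ fromℕ (f n)
open _Represents_

constₚ-represents : ∀ c → constₚ c Represents (λ _ → c)
constₚ-represents c = represents λ n → absorb (fromℕ c) (+ n / 1)
  where
  absorb : ∀ c x → c ℚ.+ x ℚ.* 0ℚ ≡ c
  absorb = solve-∀ ℚ-ring

Xₚ-represents : Xₚ Represents id
Xₚ-represents = represents λ n → trans (linear (+ n / 1)) (/1≡fromℕ n)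
  where
  linear : ∀ x → 0ℚ ℚ.+ x ℚ.* (1ℚ ℚ.+ x ℚ.* 0ℚ) ≡ x
  linear = solve-∀ ℚ-ring

+ₚ-represents : ∀ {p q f g} → p Represents f → q Represents g → (p +ₚ q) Represents (λ n → f n ℕ.+ g n)
+ₚ-represents {p} {q} {f} {g} (represents p≈f) (represents q≈g) = represents λ n →
  trans (evalPoly-+ₚ p q n) (trans (cong₂ ℚ._+_ (p≈f n) (q≈g n)) (sym (fromℕ-+ (f n) (g n))))

*ₚ-represents : ∀ {p q f g} → p Represents f → q Represents g → (p *ₚ q) Represents (λ n → f n ℕ.* g n)
*ₚ-represents {p} {q} {f} {g} (represents p≈f) (represents q≈g) = represents λ n →
  trans (evalPoly-*ₚ p q n) (trans (cong₂ ℚ._*_ (p≈f n) (q≈g n)) (sym (fromℕ-* (f n) (g n))))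

^ₚ-represents : ∀ {p f} m → p Represents f → (p ^ₚ m) Represents (λ n → f n ℕ.^ m)
^ₚ-represents zero    p≈f = constₚ-represents 1
^ₚ-represents (suc m) p≈f = *ₚ-represents p≈f (^ₚ-represents m p≈f)

-- Affine geometry of finite point configurations

InRelInt : ∀ {m n} → (Fin m → Vecℚ n) → Subset m → Vecℚ n → Set
InRelInt p σ x = Σ (Fin _ → ℚ) λ w →
  Supported σ w × (∀ i → 0ℚ ℚ.≤ w i) × (sumℚ w ≡ 1ℚ) × (lincomb w p ≋ x) × (∀ i → i ∈ₛ σ → w i ≢ 0ℚ)

InRelInt⇒InConv : ∀ {m n} {p : Fin m → Vecℚ n} {σ x} → InRelInt p σ x → InConv p σ x
InRelInt⇒InConv (w , w-supp , w≥0 , Σw≡1 , w≡x , _) = w , w-supp , w≥0 , Σw≡1 , w≡x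

module _ {m n} (p : Fin m → Vecℚ n) where

  lincomb-− : ∀ (w v : Fin m → ℚ) k → lincomb (λ i → w i ℚ.- v i) p k ≡ lincomb w p k ℚ.- lincomb v p k
  lincomb-− w v k = trans (sumℚ-cong λ i → distrib (w i) (v i) (p i k)) (sumℚ-− (λ i → w i ℚ.* p i k) (λ i → v i ℚ.* p i k))
    where
    distrib : ∀ a b c → (a ℚ.- b) ℚ.* c ≡ a ℚ.* c ℚ.- b ℚ.* c
    distrib = solve-∀ ℚ-ring

  AffInd⇒coordinates-unique : ∀ {σ w v} → AffInd p σ → Supported σ w → Supported σ v →
    sumℚ w ≡ sumℚ v → lincomb w p ≋ lincomb v p → ∀ i → w i ≡ v i
  AffInd⇒coordinates-unique {σ} {w} {v} indep w-supp v-supp Σw≡Σv w≡v i =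
    x∙y⁻¹≈ε⇒x≈y (w i) (v i) (indep (λ j → w j ℚ.- v j) d-supp Σd≡0 d≡0 i)
    where
    d-supp : Supported σ (λ j → w j ℚ.- v j)
    d-supp j j∉σ rewrite w-supp j j∉σ | v-supp j j∉σ = refl
    Σd≡0 : sumℚ (λ j → w j ℚ.- v j) ≡ 0ℚ
    Σd≡0 = trans (sumℚ-− w v) (x≈y⇒x∙y⁻¹≈ε Σw≡Σv)
    d≡0 : lincomb (λ j → w j ℚ.- v j) p ≋ 𝟎
    d≡0 k = trans (lincomb-− w v k) (x≈y⇒x∙y⁻¹≈ε (w≡v k))

  InAff⇒Nonempty : ∀ {σ x} → InAff p σ x → Nonempty σ
  InAff⇒Nonempty {σ} (w , w-supp , Σw≡1 , _) with nonempty? σ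
  ... | yes ne    = ne
  ... | no  empty = ⊥-elim (ℚ.1≢0 (trans (sym Σw≡1) (sumℚ-zero λ i → w-supp i λ i∈σ → empty (i , i∈σ))))

  InAff-vanishing : ∀ {σ x} k → (∀ i → i ∈ₛ σ → p i k ≡ 0ℚ) → InAff p σ x → x k ≡ 0ℚ
  InAff-vanishing {σ} k vanish (w , w-supp , _ , w≡x) = trans (sym (w≡x k)) (sumℚ-zero term≡0)
    where
    term≡0 : ∀ i → w i ℚ.* p i k ≡ 0ℚ
    term≡0 i with i ∈? σ
    ... | yes i∈σ = trans (cong (w i ℚ.*_) (vanish i i∈σ)) (ℚ.*-zeroʳ (w i))
    ... | no  i∉σ = trans (cong (ℚ._* p i k) (w-supp i i∉σ)) (ℚ.*-zeroˡ (p i k))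

  relInt⇒⊆ : ∀ {σ τ x} → AffInd p σ → InRelInt p σ x → InConv p (σ ∩ τ) x → σ ⊆ τ
  relInt⇒⊆ {σ} {τ} indep (w , w-supp , _ , Σw≡1 , w≡x , w≢0) (v , v-supp , _ , Σv≡1 , v≡x) {i} i∈σ
    with i ∈? σ ∩ τ
  ... | yes i∈σ∩τ = p∩q⊆q σ τ i∈σ∩τ
  ... | no  i∉σ∩τ = ⊥-elim (w≢0 i i∈σ (trans (w≗v i) (v-supp i i∉σ∩τ)))
    where
    w≗v : ∀ j → w j ≡ v j
    w≗v = AffInd⇒coordinates-unique indep w-supp (λ j j∉σ → v-supp j (j∉σ ∘ p∩q⊆p σ τ))
      (trans Σw≡1 (sym Σv≡1)) (λ k → trans (w≡x k) (sym (v≡x k)))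

  relInt-cell-unique : ∀ {T} → IsTriangulation p T → ∀ {σ τ x} → T σ → T τ →
    InRelInt p σ x → InRelInt p τ x → σ ≡ τ
  relInt-cell-unique (indep , _ , meet) {σ} {τ} {x} Tσ Tτ x∈σ x∈τ = ⊆-antisym
    (relInt⇒⊆ (indep σ Tσ) x∈σ (meet σ τ Tσ Tτ x (InRelInt⇒InConv x∈σ) (InRelInt⇒InConv x∈τ)))
    (relInt⇒⊆ (indep τ Tτ) x∈τ (meet τ σ Tτ Tσ x (InRelInt⇒InConv x∈τ) (InRelInt⇒InConv x∈σ)))

  -- If p u − p w = p u′ − p w′, the points p u + p w′ and p w + p u′ coincide, so their
  -- affine coordinates with respect to σ coincide as well.
  AffInd⇒edge-injective : ∀ {σ u w u′ w′} → AffInd p σ →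
    u ∈ₛ σ → w ∈ₛ σ → u′ ∈ₛ σ → w′ ∈ₛ σ → u ≢ w →
    (∀ k → p u k ℚ.- p w k ≡ p u′ k ℚ.- p w′ k) → u ≡ u′
  AffInd⇒edge-injective {σ} {u} {w} {u′} {w′} indep u∈σ w∈σ u′∈σ w′∈σ u≢w edges≡ with u ≟ u′
  ... | yes u≡u′ = u≡u′
  ... | no  u≢u′ = ⊥-elim (1+𝟙≢0 (begin
    1ℚ ℚ.+ 𝟙 (u ≟ w′)          ≡⟨ cong (ℚ._+ 𝟙 (u ≟ w′)) (𝟙-yes (u ≟ u) refl) ⟨
    δ₂ u w′ u                  ≡⟨ AffInd⇒coordinates-unique indep (δ₂-supp u∈σ w′∈σ) (δ₂-supp w∈σ u′∈σ)
                                    (trans (Σδ₂ u w′) (sym (Σδ₂ w u′))) sums≡ u ⟩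
    δ₂ w u′ u                  ≡⟨ cong₂ ℚ._+_ (𝟙-no (u ≟ w) u≢w) (𝟙-no (u ≟ u′) u≢u′) ⟩
    0ℚ                         ∎))
    where
    open ≡-Reasoning
    δ₂ : Fin m → Fin m → Fin m → ℚ
    δ₂ a b i = 𝟙 (i ≟ a) ℚ.+ 𝟙 (i ≟ b)
    lincomb-δ₂ : ∀ a b (f : Fin m → ℚ) → sumℚ (λ i → δ₂ a b i ℚ.* f i) ≡ f a ℚ.+ f b
    lincomb-δ₂ a b f = trans (sumℚ-cong λ i → ℚ.*-distribʳ-+ (f i) (𝟙 (i ≟ a)) (𝟙 (i ≟ b)))
      (trans (sumℚ-+ (λ i → 𝟙 (i ≟ a) ℚ.* f i) (λ i → 𝟙 (i ≟ b) ℚ.* f i))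
             (cong₂ ℚ._+_ (sumℚ-𝟙≟ a f) (sumℚ-𝟙≟ b f)))
    Σδ₂ : ∀ a b → sumℚ (δ₂ a b) ≡ 1ℚ ℚ.+ 1ℚ
    Σδ₂ a b = trans (sumℚ-cong λ i → sym (ℚ.*-identityʳ (δ₂ a b i))) (lincomb-δ₂ a b (λ _ → 1ℚ))
    δ₂-supp : ∀ {a b} → a ∈ₛ σ → b ∈ₛ σ → Supported σ (δ₂ a b)
    δ₂-supp a∈σ b∈σ i i∉σ = cong₂ ℚ._+_ (𝟙-no (i ≟ _) λ { refl → i∉σ a∈σ }) (𝟙-no (i ≟ _) λ { refl → i∉σ b∈σ })
    sums≡ : lincomb (δ₂ u w′) p ≋ lincomb (δ₂ w u′) p
    sums≡ k = trans (lincomb-δ₂ u w′ (λ i → p i k)) (trans (rearrange (p u k) (p w k) (p u′ k) (p w′ k) (edges≡ k)) (sym (lincomb-δ₂ w u′ (λ i → p i k))))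
      where
      rearrange : ∀ a b c d → a ℚ.- b ≡ c ℚ.- d → a ℚ.+ d ≡ b ℚ.+ c
      rearrange a b c d e = trans (split a b d) (trans (cong (ℚ._+ (b ℚ.+ d)) e) (merge b c d))
        where
        split : ∀ a b d → a ℚ.+ d ≡ (a ℚ.- b) ℚ.+ (b ℚ.+ d)
        split = solve-∀ ℚ-ring
        merge : ∀ b c d → (c ℚ.- d) ℚ.+ (b ℚ.+ d) ≡ b ℚ.+ c
        merge = solve-∀ ℚ-ring
    1+𝟙≢0 : 1ℚ ℚ.+ 𝟙 (u ≟ w′) ≢ 0ℚ
    1+𝟙≢0 with does (u ≟ w′)
    ... | true  = λ ()
    ... | false = λ ()

-- Configurations of points of R_A ∪ {0}

_≟ₘ_ : ∀ {n} → DecidableEquality (Maybe (Fin n))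
_≟ₘ_ = ≡-dec _≟_

e-𝟙 : ∀ {n} (i k : Fin n) → e i k ≡ 𝟙 (i ≟ k)
e-𝟙 zero    zero    = refl
e-𝟙 zero    (suc k) = refl
e-𝟙 (suc i) zero    = refl
e-𝟙 (suc i) (suc k) = e-𝟙 i k

-- v = e_pos − e_neg with e_nothing = 0 and neg ∈ A: the elements of R_A ∪ {0}.
record Elementary {n} (A : Subset n) (v : Vecℚ n) : Set where
  field
    pos neg : Maybe (Fin n)
    neg∈A   : ∀ {j} → neg ≡ just j → j ∈ₛ A
    coord   : ∀ k → v k ≡ 𝟙 (pos ≟ₘ just k) ℚ.- 𝟙 (neg ≟ₘ just k)

𝟎-Elementary : ∀ {n} {A : Subset n} → Elementary A 𝟎
𝟎-Elementary = record { pos = nothing ; neg = nothing ; neg∈A = λ () ; coord = λ _ → refl }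

InR⇒Elementary : ∀ {n} {A : Subset n} {v} → InR A v → Elementary A v
InR⇒Elementary (inj₁ (i , j , j∈A , v≡)) = record
  { pos = just i ; neg = just j ; neg∈A = λ { refl → j∈A }
  ; coord = λ k → trans (v≡ k) (trans (cong₂ (λ a b → a ℚ.+ ℚ.- 1ℚ ℚ.* b) (e-𝟙 i k) (e-𝟙 j k)) (minus (𝟙 (i ≟ k)) (𝟙 (j ≟ k)))) }
  where
  minus : ∀ a b → a ℚ.+ ℚ.- 1ℚ ℚ.* b ≡ a ℚ.- b
  minus = solve-∀ ℚ-ring
InR⇒Elementary (inj₂ (inj₁ (i , v≡))) = record
  { pos = just i ; neg = nothing ; neg∈A = λ ()
  ; coord = λ k → trans (v≡ k) (trans (e-𝟙 i k) (minus-0 (𝟙 (i ≟ k)))) }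
  where
  minus-0 : ∀ a → a ≡ a ℚ.- 0ℚ
  minus-0 = solve-∀ ℚ-ring
InR⇒Elementary (inj₂ (inj₂ (j , j∈A , v≡))) = record
  { pos = nothing ; neg = just j ; neg∈A = λ { refl → j∈A }
  ; coord = λ k → trans (v≡ k) (trans (cong (ℚ.- 1ℚ ℚ.*_) (e-𝟙 j k)) (negate (𝟙 (j ≟ k)))) }
  where
  negate : ∀ b → ℚ.- 1ℚ ℚ.* b ≡ 0ℚ ℚ.- b
  negate = solve-∀ ℚ-ring

module _ {m n} (p : Fin m → Vecℚ n) where

  vertexSum : Subset m → Vecℚ n
  vertexSum σ = lincomb (λ i → 𝟙 (i ∈? σ)) p

  barycentre-InRelInt : ∀ {σ t} → 0ℚ ℚ.≤ t → t ℚ.* fromℕ ∣ σ ∣ ≡ 1ℚ →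
    InRelInt p σ (λ k → t ℚ.* vertexSum σ k)
  barycentre-InRelInt {σ} {t} t≥0 t*∣σ∣≡1 = w , w-supp , w≥0 , Σw≡1 , w≡x , w≢0
    where
    w : Fin m → ℚ
    w i = t ℚ.* 𝟙 (i ∈? σ)
    w-supp : Supported σ w
    w-supp i i∉σ = trans (cong (t ℚ.*_) (𝟙-no (i ∈? σ) i∉σ)) (ℚ.*-zeroʳ t)
    w≥0 : ∀ i → 0ℚ ℚ.≤ w i
    w≥0 i with does (i ∈? σ)
    ... | true  = subst (0ℚ ℚ.≤_) (sym (ℚ.*-identityʳ t)) t≥0
    ... | false = ℚ.≤-reflexive (sym (ℚ.*-zeroʳ t))
    Σw≡1 : sumℚ w ≡ 1ℚ
    Σw≡1 = begin
      sumℚ w                                     ≡⟨ sumℚ-*ˡ t (λ i → 𝟙 (i ∈? σ)) ⟩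
      t ℚ.* sumℚ (λ i → 𝟙 (i ∈? σ))              ≡⟨ cong (t ℚ.*_) (sumℚ-𝟙 (_∈? σ) id) ⟩
      t ℚ.* fromℕ (length (members (_∈? σ)))     ≡⟨ cong (λ c → t ℚ.* fromℕ c) (length-members-∈? σ) ⟩
      t ℚ.* fromℕ ∣ σ ∣                          ≡⟨ t*∣σ∣≡1 ⟩
      1ℚ                                         ∎
      where open ≡-Reasoning
    w≡x : lincomb w p ≋ (λ k → t ℚ.* vertexSum σ k)
    w≡x k = trans (sumℚ-cong λ i → ℚ.*-assoc t (𝟙 (i ∈? σ)) (p i k)) (sumℚ-*ˡ t (λ i → 𝟙 (i ∈? σ) ℚ.* p i k))
    w≢0 : ∀ i → i ∈ₛ σ → w i ≢ 0ℚ
    w≢0 i i∈σ w≡0 = ℚ.1≢0 (begin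
      1ℚ                          ≡⟨ t*∣σ∣≡1 ⟨
      t ℚ.* fromℕ ∣ σ ∣           ≡⟨ cong (ℚ._* fromℕ ∣ σ ∣) t≡0 ⟩
      0ℚ ℚ.* fromℕ ∣ σ ∣          ≡⟨ ℚ.*-zeroˡ (fromℕ ∣ σ ∣) ⟩
      0ℚ                          ∎)
      where
      open ≡-Reasoning
      t≡0 : t ≡ 0ℚ
      t≡0 = trans (sym (ℚ.*-identityʳ t)) (trans (cong (t ℚ.*_) (sym (𝟙-yes (i ∈? σ) i∈σ))) w≡0)

labels : ∀ {n} → Subset n → List (Maybe (Fin n))
labels B = nothing ∷ map just (members (_∈? B))

length-labels : ∀ {n} (B : Subset n) → length (labels B) ≡ suc ∣ B ∣
length-labels B = cong suc (trans (length-map just (members (_∈? B))) (length-members-∈? B))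

∈-labels : ∀ {n} {B : Subset n} a → (∀ {j} → a ≡ just j → j ∈ₛ B) → a ∈ labels B
∈-labels nothing  _   = here refl
∈-labels (just j) j∈B = there (∈-map⁺ just (∈-members⁺ (_∈? _) (j∈B refl)))

module ElementaryConfiguration {n l} {A : Subset n} {p : Fin (suc l) → Vecℚ n}
                               (elem : ∀ i → Elementary A (p i)) where

  pos neg : Fin (suc l) → Maybe (Fin n)
  pos i = Elementary.pos (elem i)
  neg i = Elementary.neg (elem i)

  coord : ∀ i {a b} → pos i ≡ a → neg i ≡ b → ∀ k → p i k ≡ 𝟙 (a ≟ₘ just k) ℚ.- 𝟙 (b ≟ₘ just k)
  coord i refl refl = Elementary.coord (elem i)

  neg∉ : ∀ i {k} → k ∉ₛ A → neg i ≢ just k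
  neg∉ i k∉A neg≡k = k∉A (Elementary.neg∈A (elem i) neg≡k)

  posIn? : ∀ σ k → Decidable (λ i → i ∈ₛ σ × pos i ≡ just k)
  posIn? σ k i = i ∈? σ ×-dec pos i ≟ₘ just k

  negIn? : ∀ σ k → Decidable (λ i → i ∈ₛ σ × neg i ≡ just k)
  negIn? σ k i = i ∈? σ ×-dec neg i ≟ₘ just k

  posCount negCount : Subset (suc l) → Fin n → ℕ
  posCount σ k = length (members (posIn? σ k))
  negCount σ k = length (members (negIn? σ k))

  vertexSum-coord : ∀ σ k → vertexSum p σ k ≡ fromℕ (posCount σ k) ℚ.- fromℕ (negCount σ k)
  vertexSum-coord σ k = begin
    sumℚ (λ i → 𝟙 (i ∈? σ) ℚ.* p i k)                                  ≡⟨ sumℚ-cong term ⟩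
    sumℚ (λ i → 𝟙 (posIn? σ k i) ℚ.- 𝟙 (negIn? σ k i))                 ≡⟨ sumℚ-− (𝟙 ∘ posIn? σ k) (𝟙 ∘ negIn? σ k) ⟩
    sumℚ (𝟙 ∘ posIn? σ k) ℚ.- sumℚ (𝟙 ∘ negIn? σ k)                    ≡⟨ cong₂ ℚ._-_ (sumℚ-𝟙 (posIn? σ k) id) (sumℚ-𝟙 (negIn? σ k) id) ⟩
    fromℕ (posCount σ k) ℚ.- fromℕ (negCount σ k)                      ∎
    where
    open ≡-Reasoning
    term : ∀ i → 𝟙 (i ∈? σ) ℚ.* p i k ≡ 𝟙 (posIn? σ k i) ℚ.- 𝟙 (negIn? σ k i)
    term i rewrite coord i refl refl k with does (i ∈? σ)
    ... | true  = ℚ.*-identityˡ (𝟙 (pos i ≟ₘ just k) ℚ.- 𝟙 (neg i ≟ₘ just k))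
    ... | false = ℚ.*-zeroˡ (𝟙 (pos i ≟ₘ just k) ℚ.- 𝟙 (neg i ≟ₘ just k))

  negCount-outside : ∀ σ {k} → k ∉ₛ A → negCount σ k ≡ 0
  negCount-outside σ k∉A = members-none (negIn? σ _) λ i (_ , neg≡k) → neg∉ i k∉A neg≡k

  -- If pos j = k, the k-th coordinate would vanish on the vertices of σ, hence on their
  -- affine hull, which contains p j; but p j k = 1.
  posCount≡0⇒unused : ∀ {σ k} → TopDim p σ → k ∉ₛ A → posCount σ k ≡ 0 → ∀ j → pos j ≢ just k
  posCount≡0⇒unused {σ} {k} (_ , spans) k∉A count≡0 j pos≡k = ℚ.1≢0 (begin
    1ℚ                                            ≡⟨ cong₂ ℚ._-_ (𝟙-yes (just k ≟ₘ just k) refl)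
                                                                   (𝟙-no (neg j ≟ₘ just k) (neg∉ j k∉A)) ⟨
    𝟙 (just k ≟ₘ just k) ℚ.- 𝟙 (neg j ≟ₘ just k)  ≡⟨ coord j pos≡k refl k ⟨
    p j k                                         ≡⟨ InAff-vanishing p k vanish (spans j) ⟩
    0ℚ                                            ∎)
    where
    open ≡-Reasoning
    vanish : ∀ i → i ∈ₛ σ → p i k ≡ 0ℚ
    vanish i i∈σ = trans (coord i refl refl k)
      (cong₂ ℚ._-_ (𝟙-no (pos i ≟ₘ just k) λ pos≡k → length-members≡0⇒¬ (posIn? σ k) count≡0 (i∈σ , pos≡k))
                   (𝟙-no (neg i ≟ₘ just k) (neg∉ i k∉A)))

  unused⇒posCount≡0 : ∀ σ {k} → (∀ j → pos j ≢ just k) → posCount σ k ≡ 0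
  unused⇒posCount≡0 σ unused = members-none (posIn? σ _) λ j (_ , pos≡k) → unused j pos≡k

  posCount-agree : ∀ {σ τ k} → TopDim p σ → TopDim p τ → k ∉ₛ A →
    posCount σ k ℕ.< 2 → posCount τ k ℕ.< 2 → posCount σ k ≡ posCount τ k
  posCount-agree {σ} {τ} {k} σ-top τ-top k∉A σ<2 τ<2
    with posCount σ k in σ≡ | posCount τ k in τ≡
  ... | 0     | 0     = refl
  ... | 1     | 1     = refl
  ... | 0     | suc _ = contradiction (trans (sym τ≡) (unused⇒posCount≡0 τ (posCount≡0⇒unused σ-top k∉A σ≡))) λ ()
  ... | suc _ | 0     = contradiction (trans (sym σ≡) (unused⇒posCount≡0 σ (posCount≡0⇒unused τ-top k∉A τ≡))) λ ()
  ... | suc (suc _) | _ = contradiction σ<2 λ { (s≤s (s≤s ())) }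
  ... | 1 | suc (suc _) = contradiction τ<2 λ { (s≤s (s≤s ())) }

  Split : Subset (suc l) → Fin n → Maybe (Fin n) × Maybe (Fin n) → Set
  Split σ k (a , b) = ∃ λ u → ∃ λ w → u ≢ w ×
    (u ∈ₛ σ × pos u ≡ just k) × (w ∈ₛ σ × pos w ≡ just k) × neg u ≡ a × neg w ≡ b

  -- Both edges u − w and u′ − w′ equal e_b − e_a.
  Split-injective : ∀ {σ k k′ ab} → AffInd p σ → Split σ k ab → Split σ k′ ab → k ≡ k′
  Split-injective {σ} {k} {k′} {a , b} indep
    (u  , w  , u≢w , (u∈σ  , pos-u)  , (w∈σ  , pos-w)  , neg-u  , neg-w)
    (u′ , w′ , _   , (u′∈σ , pos-u′) , (w′∈σ , pos-w′) , neg-u′ , neg-w′) =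
    just-injective (trans (sym pos-u) (trans (cong pos u≡u′) pos-u′))
    where
    cancel : ∀ x y a b → (x ℚ.- a) ℚ.- (x ℚ.- b) ≡ (y ℚ.- a) ℚ.- (y ℚ.- b)
    cancel = solve-∀ ℚ-ring
    edges≡ : ∀ k₀ → p u k₀ ℚ.- p w k₀ ≡ p u′ k₀ ℚ.- p w′ k₀
    edges≡ k₀ = trans (cong₂ ℚ._-_ (coord u pos-u neg-u k₀) (coord w pos-w neg-w k₀))
      (trans (cancel (𝟙 (just k ≟ₘ just k₀)) (𝟙 (just k′ ≟ₘ just k₀)) (𝟙 (a ≟ₘ just k₀)) (𝟙 (b ≟ₘ just k₀)))
             (sym (cong₂ ℚ._-_ (coord u′ pos-u′ neg-u′ k₀) (coord w′ pos-w′ neg-w′ k₀))))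
    u≡u′ : u ≡ u′
    u≡u′ = AffInd⇒edge-injective p indep u∈σ w∈σ u′∈σ w′∈σ u≢w edges≡

  split? : ∀ σ → Decidable (λ k → 2 ≤ posCount σ k)
  split? σ k = 2 ℕ.≤? posCount σ k

  split-count : ∀ {σ} → AffInd p σ → length (members (split? σ)) ≤ suc ∣ A ∣ ℕ.* suc ∣ A ∣
  split-count {σ} indep = begin
    length (members (split? σ))
      ≤⟨ injection⇒length≤ (Split σ) (members-unique (split? σ)) splitting (λ _ _ → Split-injective indep) ⟩
    length (cartesianProduct (labels A) (labels A))
      ≡⟨ length-cartesianProductWith _,_ (labels A) (labels A) ⟩
    length (labels A) ℕ.* length (labels A)
      ≡⟨ cong₂ ℕ._*_ (length-labels A) (length-labels A) ⟩
    suc ∣ A ∣ ℕ.* suc ∣ A ∣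
      ∎
    where
    open ℕ.≤-Reasoning
    splitting : ∀ {k} → k ∈ members (split? σ) → ∃ λ ab → ab ∈ cartesianProduct (labels A) (labels A) × Split σ k ab
    splitting {k} k∈ with u , w , u≢w , u-in , w-in ← two-members (posIn? σ k) (∈-members⁻ (split? σ) k∈) =
      (neg u , neg w) ,
      ∈-cartesianProduct⁺ (∈-labels (neg u) (Elementary.neg∈A (elem u))) (∈-labels (neg w) (Elementary.neg∈A (elem w))) ,
      (u , w , u≢w , u-in , w-in , refl , refl)

  relevant? : ∀ σ → Decidable (λ k → k ∈ₛ A ⊎ 2 ≤ posCount σ k)
  relevant? σ k = k ∈? A ⊎-dec split? σ k

  relevant-count : ∀ {σ} → AffInd p σ → length (members (relevant? σ)) ≤ ∣ A ∣ ℕ.+ suc ∣ A ∣ ℕ.* suc ∣ A ∣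
  relevant-count {σ} indep = begin
    length (members (relevant? σ))
      ≤⟨ subset⇒length≤ (members-unique (relevant? σ)) (from-either ∘ ∈-members⁻ (relevant? σ)) ⟩
    length (members (_∈? A) ++ members (split? σ))
      ≡⟨ length-++ (members (_∈? A)) ⟩
    length (members (_∈? A)) ℕ.+ length (members (split? σ))
      ≤⟨ ℕ.+-mono-≤ (ℕ.≤-reflexive (length-members-∈? A)) (split-count indep) ⟩
    ∣ A ∣ ℕ.+ suc ∣ A ∣ ℕ.* suc ∣ A ∣
      ∎
    where
    open ℕ.≤-Reasoning
    from-either : ∀ {k} → k ∈ₛ A ⊎ 2 ≤ posCount σ k → k ∈ members (_∈? A) ++ members (split? σ)
    from-either (inj₁ k∈A) = ∈-++⁺ˡ (∈-members⁺ (_∈? A) k∈A)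
    from-either (inj₂ 2≤)  = ∈-++⁺ʳ (members (_∈? A)) (∈-members⁺ (split? σ) 2≤)

  entry : Subset (suc l) → Fin n → Fin n × ℕ × ℕ
  entry σ k = k , posCount σ k , negCount σ k

  -- The barycentre of σ is determined by its code: outside the relevant directions,
  -- the entries are forced by the configuration alone.
  code : Subset (suc l) → ℕ × List (Fin n × ℕ × ℕ)
  code σ = ∣ σ ∣ , map (entry σ) (members (relevant? σ))

  relevant-entry : ∀ {σ τ k} → code σ ≡ code τ → k ∈ₛ A ⊎ 2 ≤ posCount σ k → entry σ k ≡ entry τ k
  relevant-entry {σ} {τ} {k} code≡ relevant
    with k′ , _ , entry≡ ← ∈-map⁻ (entry τ) (subst (entry σ k ∈_) (cong proj₂ code≡)
                              (∈-map⁺ (entry σ) (∈-members⁺ (relevant? σ) relevant)))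
    with refl ← cong proj₁ entry≡ = entry≡

  entry-agree : ∀ {σ τ} → TopDim p σ → TopDim p τ → code σ ≡ code τ → ∀ k → entry σ k ≡ entry τ k
  entry-agree {σ} {τ} σ-top τ-top code≡ k with relevant? σ k | relevant? τ k
  ... | yes relevant | _           = relevant-entry {σ} {τ} code≡ relevant
  ... | no  _        | yes relevant = sym (relevant-entry {τ} {σ} (sym code≡) relevant)
  ... | no  ¬σ       | no  ¬τ       = cong (k ,_) (cong₂ _,_
    (posCount-agree σ-top τ-top k∉A (ℕ.≰⇒> (¬σ ∘ inj₂)) (ℕ.≰⇒> (¬τ ∘ inj₂)))
    (trans (negCount-outside σ k∉A) (sym (negCount-outside τ k∉A))))
    where
    k∉A : k ∉ₛ A
    k∉A = ¬σ ∘ inj₁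

  code-injective : ∀ {T σ τ} → IsTriangulation p T → T σ → T τ → TopDim p σ → TopDim p τ →
    code σ ≡ code τ → σ ≡ τ
  code-injective {T} {σ} {τ} tri Tσ Tτ σ-top τ-top code≡
    with t , t≥0 , t∣σ∣≡1 ← fromℕ-invertible (Nonempty⇒∣p∣>0 (InAff⇒Nonempty p (proj₂ σ-top zero))) =
    relInt-cell-unique p tri Tσ Tτ (barycentre-InRelInt p {σ} t≥0 t∣σ∣≡1) barycentre-in-τ
    where
    sums≡ : vertexSum p τ ≋ vertexSum p σ
    sums≡ k = begin
      vertexSum p τ k                                ≡⟨ vertexSum-coord τ k ⟩
      fromℕ (posCount τ k) ℚ.- fromℕ (negCount τ k)  ≡⟨ cong (λ (_ , a , b) → fromℕ a ℚ.- fromℕ b) (entry-agree τ-top σ-top (sym code≡) k) ⟩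
      fromℕ (posCount σ k) ℚ.- fromℕ (negCount σ k)  ≡⟨ vertexSum-coord σ k ⟨
      vertexSum p σ k                                ∎
      where open ≡-Reasoning
    barycentre-in-τ : InRelInt p τ (λ k → t ℚ.* vertexSum p σ k)
    barycentre-in-τ
      with w , w-supp , w≥0 , Σw≡1 , w≡x , w≢0 ←
           barycentre-InRelInt p {τ} t≥0 (subst (λ s → t ℚ.* fromℕ s ≡ 1ℚ) (cong proj₁ code≡) t∣σ∣≡1) =
      w , w-supp , w≥0 , Σw≡1 , (λ k → trans (w≡x k) (cong (t ℚ.*_) (sums≡ k))) , w≢0

  entries : ℕ → List (Fin n × ℕ × ℕ)
  entries V = cartesianProduct (allFin n) (cartesianProduct (upTo V) (upTo V))

  codes : ℕ → ℕ → List (ℕ × List (Fin n × ℕ × ℕ))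
  codes R V = cartesianProduct (upTo V) (lists≤ R (entries V))

  code∈codes : ∀ {σ R V} → AffInd p σ → ∣ A ∣ ℕ.+ suc ∣ A ∣ ℕ.* suc ∣ A ∣ ≤ R → suc l ℕ.< V →
    code σ ∈ codes R V
  code∈codes {σ} {R} {V} indep R-large V-large =
    ∈-cartesianProduct⁺ (bounded (∣p∣≤n σ))
      (∈-lists≤ R (All.map⁺ (All.universal entry∈ (members (relevant? σ))))
        (ℕ.≤-trans (ℕ.≤-reflexive (length-map (entry σ) (members (relevant? σ))))
                   (ℕ.≤-trans (relevant-count indep) R-large)))
    where
    bounded : ∀ {c} → c ≤ suc l → c ∈ upTo V
    bounded c≤ = ∈-upTo⁺ (ℕ.≤-<-trans c≤ V-large)
    entry∈ : ∀ k → entry σ k ∈ entries V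
    entry∈ k = ∈-cartesianProduct⁺ (∈-allFin k)
      (∈-cartesianProduct⁺ (bounded (length-members≤ (posIn? σ k))) (bounded (length-members≤ (negIn? σ k))))

  length-entries : ∀ V → length (entries V) ≡ n ℕ.* (V ℕ.* V)
  length-entries V = trans (length-cartesianProductWith _,_ (allFin n) _)
    (cong₂ ℕ._*_ (length-tabulate {n = n} id) (trans (length-cartesianProductWith _,_ (upTo V) (upTo V))
                                                      (cong₂ ℕ._*_ (length-upTo V) (length-upTo V))))

  length-codes : ∀ R V → length (codes R V) ≤ V ℕ.* suc (n ℕ.* (V ℕ.* V)) ℕ.^ R
  length-codes R V = begin
    length (codes R V)                                ≡⟨ length-cartesianProductWith _,_ (upTo V) (lists≤ R (entries V)) ⟩
    length (upTo V) ℕ.* length (lists≤ R (entries V)) ≤⟨ ℕ.*-mono-≤ (ℕ.≤-reflexive (length-upTo V)) (length-lists≤ R (entries V)) ⟩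
    V ℕ.* suc (length (entries V)) ℕ.^ R              ≡⟨ cong (λ c → V ℕ.* suc c ℕ.^ R) (length-entries V) ⟩
    V ℕ.* suc (n ℕ.* (V ℕ.* V)) ℕ.^ R                 ∎
    where open ℕ.≤-Reasoning

distinct-Elementary-count : ∀ {n l} {A : Subset n} {v : Fin l → Vecℚ n} → (∀ i → Elementary A (v i)) →
  (∀ i j → v i ≋ v j → i ≡ j) → l ≤ suc n ℕ.* suc n
distinct-Elementary-count {n} {l} {A} {v} elem distinct = begin
  l                                ≡⟨ length-tabulate {n = l} id ⟨
  length (allFin l)                ≤⟨ injection⇒length≤ HasSigns (allFin⁺ l) signs-∈ signs-injective ⟩
  length signPairs                 ≡⟨ length-cartesianProductWith _,_ (labels (⊤ {n})) (labels (⊤ {n})) ⟩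
  length (labels (⊤ {n})) ℕ.* length (labels (⊤ {n}))
                                   ≡⟨ cong₂ ℕ._*_ (length-labels (⊤ {n})) (length-labels (⊤ {n})) ⟩
  suc ∣ ⊤ {n} ∣ ℕ.* suc ∣ ⊤ {n} ∣  ≡⟨ cong (λ c → suc c ℕ.* suc c) (∣⊤∣≡n n) ⟩
  suc n ℕ.* suc n                  ∎
  where
  open ℕ.≤-Reasoning
  signPairs : List (Maybe (Fin n) × Maybe (Fin n))
  signPairs = cartesianProduct (labels (⊤ {n})) (labels (⊤ {n}))
  signs : Fin l → Maybe (Fin n) × Maybe (Fin n)
  signs i = Elementary.pos (elem i) , Elementary.neg (elem i)
  HasSigns : Fin l → Maybe (Fin n) × Maybe (Fin n) → Set
  HasSigns i ab = signs i ≡ ab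
  signs-∈ : ∀ {i} → i ∈ allFin l → ∃ λ ab → ab ∈ signPairs × HasSigns i ab
  signs-∈ {i} _ = signs i , ∈-cartesianProduct⁺ (∈-labels _ (λ _ → ∈⊤)) (∈-labels _ (λ _ → ∈⊤)) , refl
  signs-injective : ∀ {i j ab} → i ∈ allFin l → j ∈ allFin l → HasSigns i ab → HasSigns j ab → i ≡ j
  signs-injective {i} {j} _ _ refl signs≡ = distinct i j λ k →
    trans (Elementary.coord (elem i) k)
      (trans (cong (λ (a , b) → 𝟙 (a ≟ₘ just k) ℚ.- 𝟙 (b ≟ₘ just k)) (sym signs≡))
             (sym (Elementary.coord (elem j) k)))

-- The bound

sizeBound : ℕ → ℕ
sizeBound n = 2 ℕ.+ suc n ℕ.* suc n

entryBound : ℕ → ℕ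
entryBound r = r ℕ.+ suc r ℕ.* suc r

bound : ℕ → ℕ → ℕ
bound r n = sizeBound n ℕ.* suc (n ℕ.* (sizeBound n ℕ.* sizeBound n)) ℕ.^ entryBound r

sizeBoundₚ : List ℚ
sizeBoundₚ = constₚ 2 +ₚ (constₚ 1 +ₚ Xₚ) *ₚ (constₚ 1 +ₚ Xₚ)

sizeBoundₚ-represents : sizeBoundₚ Represents sizeBound
sizeBoundₚ-represents = +ₚ-represents (constₚ-represents 2) (*ₚ-represents 1+X≈ 1+X≈)
  where
  1+X≈ : (constₚ 1 +ₚ Xₚ) Represents suc
  1+X≈ = +ₚ-represents (constₚ-represents 1) Xₚ-represents

boundₚ : ℕ → List ℚ
boundₚ r = sizeBoundₚ *ₚ (constₚ 1 +ₚ Xₚ *ₚ (sizeBoundₚ *ₚ sizeBoundₚ)) ^ₚ entryBound r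

boundₚ-represents : ∀ r → boundₚ r Represents bound r
boundₚ-represents r = *ₚ-represents sizeBoundₚ-represents (^ₚ-represents (entryBound r)
  (+ₚ-represents (constₚ-represents 1)
    (*ₚ-represents Xₚ-represents (*ₚ-represents sizeBoundₚ-represents sizeBoundₚ-represents))))

topSimplices≤bound : ∀ {r n} {A : Subset n} → ∣ A ∣ ≤ r →
  ∀ {l} {rs : Fin l → Vecℚ n} → (∀ i → InR A (rs i)) → (∀ i j → rs i ≋ rs j → i ≡ j) →
  ∀ {T} → IsTriangulation (points rs) T →
  ∀ {L} → Unique L → All (λ σ → T σ × TopDim (points rs) σ) L → length L ≤ bound r n
topSimplices≤bound {r} {n} {A} ∣A∣≤r {l} {rs} rs∈R distinct {T} tri {L} L-unique L-top = begin
  length L                                     ≤⟨ injection⇒length≤ HasCode L-unique code∈ HasCode-injective ⟩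
  length (codes (entryBound r) (sizeBound n))  ≤⟨ length-codes (entryBound r) (sizeBound n) ⟩
  bound r n                                    ∎
  where
  open ℕ.≤-Reasoning
  elem : ∀ i → Elementary A (points rs i)
  elem zero    = 𝟎-Elementary
  elem (suc i) = InR⇒Elementary (rs∈R i)
  open ElementaryConfiguration elem
  HasCode : Subset (suc l) → ℕ × List (Fin n × ℕ × ℕ) → Set
  HasCode σ c = code σ ≡ c
  code∈ : ∀ {σ} → σ ∈ L → ∃ λ c → c ∈ codes (entryBound r) (sizeBound n) × HasCode σ c
  code∈ {σ} σ∈L = code σ , code∈codes {σ} (proj₁ (proj₂ (All.lookup L-top σ∈L)))
    (ℕ.+-mono-≤ ∣A∣≤r (ℕ.*-mono-≤ (s≤s ∣A∣≤r) (s≤s ∣A∣≤r)))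
    (s≤s (s≤s (distinct-Elementary-count (InR⇒Elementary ∘ rs∈R) distinct))) , refl
  HasCode-injective : ∀ {σ τ c} → σ ∈ L → τ ∈ L → HasCode σ c → HasCode τ c → σ ≡ τ
  HasCode-injective σ∈L τ∈L code≡c code′≡c
    with Tσ , σ-top ← All.lookup L-top σ∈L | Tτ , τ-top ← All.lookup L-top τ∈L =
    code-injective tri Tσ Tτ σ-top τ-top (trans code≡c (sym code′≡c))

lemma2p6 : (r : ℕ) → Σ (List ℚ) λ q →
    (n : ℕ) (A : Subset n) → ∣ A ∣ Data.Nat.≤ r →
    (l : ℕ) (rs : Fin l → Vecℚ n) →
    (∀ i → InR A (rs i)) →
    (∀ i j → rs i ≋ rs j → i ≡ j) →
    (∀ i → IsExtremalRay (InCone rs) (rs i)) →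
    (T : Subset (suc l) → Set) → IsTriangulation (points rs) T →
    (L : List (Subset (suc l))) → Unique L →
    All (λ σ → T σ × TopDim (points rs) σ) L →
    (+ length L / 1) Data.Rational.≤ evalPoly q n
lemma2p6 r = boundₚ r , λ n A ∣A∣≤r l rs rs∈R distinct _ T tri L L-unique L-top → begin
  + length L / 1          ≡⟨ /1≡fromℕ (length L) ⟩
  fromℕ (length L)        ≤⟨ fromℕ-mono (topSimplices≤bound ∣A∣≤r rs∈R distinct tri L-unique L-top) ⟩
  fromℕ (bound r n)       ≡⟨ evalPoly≡ (boundₚ-represents r) n ⟨
  evalPoly (boundₚ r) n   ∎
  where open ℚ.≤-Reasoning
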